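{- Let $G$ be a finite simple connected graph that has at least one perfect matching, and let $t$ be a real number such that for every induced subgraph $H$ of $G$ there exists a vertex $v\in V(H)$ with $\mathrm{avg}_H(v)\le t$. Then \[\mathrm{cf}(G) \le \left(1 - \frac{1}{t}\right) |E(G)|.\]
   Context: For a graph $H$ and vertex $v$, let $d_v$ be the degree of $v$ in $H$ and $t_v=\sum_{u\in N_H(v)} d_u$ (the 2-degree of $v$). The average 2-degree is $\mathrm{avg}_H(v)=t_v/d_v$ if $d_v\neq 0$ and $\mathrm{avg}_H(v)=0$ if $d_v=0$. A perfect matching of $G$ is a set of pairwise disjoint edges covering every vertex. For a perfect matching $M$, a subset $S\subseteq M$ is a forcing set of $M$ if $M$ is the unique perfect matching of $G$ containing $S$. A subset $S\subseteq E(G)$ is a complete forcing set of $G$ if for every perfect matching $M$ of $G$, $S\cap M$ is a forcing set of $M$. $\mathrm{cf}(G)$ is the minimum size of a complete forcing set of $G$.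
   Formalization: The parameter t ranges over the rationals instead of the reals. -}

module Defs where

open import Data.Bool using (Bool; true; false; _∧_; if_then_else_)
open import Data.Nat using (ℕ; zero; suc; _+_)
open import Data.Fin using (Fin; _<?_)
open import Data.List using (List; map; allFin)
open import Data.Nat.ListAction using (sum)
open import Data.Product using (Σ; _×_; ∃; ∃-syntax)
open import Data.Integer using (+_)
open import Data.Rational using (ℚ; 0ℚ; _/_)
open import Relation.Nullary.Decidable using (⌊_⌋)
open import Relation.Binary.PropositionalEquality using (_≡_)

record Graph (n : ℕ) : Set where
  field
    adj   : Fin n → Fin n → Bool
    sym   : ∀ i j → adj i j ≡ adj j i
    irref : ∀ i → adj i i ≡ false
open Graph public

Σv : {n : ℕ} → (Fin n → ℕ) → ℕ
Σv {n} f = sum (map f (allFin n))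

-- A set of (unordered) vertex pairs, represented as a Boolean relation.
PairSet : ℕ → Set
PairSet n = Fin n → Fin n → Bool

∣_∣ₚ : {n : ℕ} → PairSet n → ℕ
∣ S ∣ₚ = Σv (λ i → Σv (λ j → if ⌊ i <? j ⌋ ∧ S i j then 1 else 0))

numEdges : {n : ℕ} → Graph n → ℕ
numEdges G = ∣ adj G ∣ₚ

_⊆ₚ_ : {n : ℕ} → PairSet n → PairSet n → Set
S ⊆ₚ T = ∀ i j → S i j ≡ true → T i j ≡ true

_∩ₚ_ : {n : ℕ} → PairSet n → PairSet n → PairSet n
(S ∩ₚ T) i j = S i j ∧ T i j

IsEdgeSet : {n : ℕ} → Graph n → PairSet n → Set
IsEdgeSet G S = (∀ i j → S i j ≡ S j i) × (S ⊆ₚ adj G)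

IsPerfectMatching : {n : ℕ} → Graph n → PairSet n → Set
IsPerfectMatching G M =
  IsEdgeSet G M × (∀ i → ∃[ j ] (M i j ≡ true × (∀ k → M i k ≡ true → k ≡ j)))

IsForcingSet : {n : ℕ} → Graph n → PairSet n → PairSet n → Set
IsForcingSet G M S =
  (S ⊆ₚ M) × (∀ M′ → IsPerfectMatching G M′ → S ⊆ₚ M′ → ∀ i j → M′ i j ≡ M i j)

IsCompleteForcingSet : {n : ℕ} → Graph n → PairSet n → Set
IsCompleteForcingSet G S =
  IsEdgeSet G S × (∀ M → IsPerfectMatching G M → IsForcingSet G M (S ∩ₚ M))

data Reachable {n : ℕ} (G : Graph n) : Fin n → Fin n → Set where
  here : ∀ {i} → Reachable G i i
  step : ∀ {i k j} → adj G i k ≡ true → Reachable G k j → Reachable G i j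

Connected : {n : ℕ} → Graph n → Set
Connected G = ∀ i j → Reachable G i j

HasPerfectMatching : {n : ℕ} → Graph n → Set
HasPerfectMatching G = ∃[ M ] IsPerfectMatching G M

-- Induced subgraph H = G[U], U a vertex subset.
-- Degree of v in G[U] (for v ∈ U).
degIn : {n : ℕ} → Graph n → (Fin n → Bool) → Fin n → ℕ
degIn G U v = Σv (λ u → if U u ∧ adj G v u then 1 else 0)

twoDegIn : {n : ℕ} → Graph n → (Fin n → Bool) → Fin n → ℕ
twoDegIn G U v = Σv (λ u → if U u ∧ adj G v u then degIn G U u else 0)

-- Average 2-degree t_v / d_v (0 if d_v = 0).
avgFrom : ℕ → ℕ → ℚ
avgFrom t zero    = 0ℚ
avgFrom t (suc d) = (+ t) / suc d

avgIn : {n : ℕ} → Graph n → (Fin n → Bool) → Fin n → ℚ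
avgIn G U v = avgFrom (twoDegIn G U v) (degIn G U v)

ℕ→ℚ : ℕ → ℚ
ℕ→ℚ m = (+ m) / 1

{-# OPTIONS --safe #-}
-- Greedily pick a vertex c of the current induced subgraph H with avg_H(c) ≤ t, put the
-- star of c in H into a set T, and delete the closed neighbourhood N_H[c]. An edge of H lost
-- in this step has an endpoint in N_H(c), so at most t_c ≤ t·d_c edges are lost while the
-- star contributes d_c edges to T; hence |E(G)| ≤ t·|T|.
--
-- S = E(G) ∖ T is a complete forcing set. Let M, M′ be perfect matchings agreeing on S, so
-- every edge of M ∖ M′ lies in T. If cx ∈ M ∖ M′ is an edge of the star at c, let cy ∈ M′
-- and yz ∈ M. Then yz ∈ M ∖ M′ lies in T, and since y is a neighbour of c it was deleted
-- when c was picked, so yz belongs to a star picked strictly earlier than c's. This infinite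
-- descent shows M ⊆ M′, so M = M′. Finally |S| = |E(G)| − |T| ≤ (1 − 1/t)·|E(G)|.
module Submission where

open import Defs renaming (sym to adj-sym; irref to adj-irrefl)
open import Data.Nat using (ℕ)
import Data.Rational

module RationalBounds where

  open import Data.Integer as ℤ using (+_)
  import Data.Integer.Properties as ℤ
  open import Data.Nat as ℕ using (zero; suc)
  import Data.Nat.Properties as ℕ
  open import Data.Nat.Coprimality as Coprime using (1-coprimeTo)
  open import Data.Rational
  open import Data.Rational.Properties
  open import Data.Rational.Solver using (module +-*-Solver)
  import Data.Rational.Unnormalised as ℚᵘ
  import Data.Rational.Unnormalised.Properties as ℚᵘ
  open import Relation.Binary.PropositionalEquality

  ℕ→ℚ≡mkℚ : ∀ m → ℕ→ℚ m ≡ mkℚ (+ m) 0 (Coprime.sym (1-coprimeTo m))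
  ℕ→ℚ≡mkℚ m = normalize-coprime (Coprime.sym (1-coprimeTo m))

  ℕ→ℚ-+ : ∀ a b → ℕ→ℚ (a ℕ.+ b) ≡ ℕ→ℚ a + ℕ→ℚ b
  ℕ→ℚ-+ a b rewrite ℕ→ℚ≡mkℚ a | ℕ→ℚ≡mkℚ b =
    cong₂ (λ x y → (x ℤ.+ y) / 1) (sym (ℤ.*-identityʳ (+ a))) (sym (ℤ.*-identityʳ (+ b)))

  ℕ→ℚ-mono-≤ : ∀ {a b} → a ℕ.≤ b → ℕ→ℚ a ≤ ℕ→ℚ b
  ℕ→ℚ-mono-≤ {a} {b} a≤b rewrite ℕ→ℚ≡mkℚ a | ℕ→ℚ≡mkℚ b =
    *≤* (ℤ.*-monoʳ-≤-nonNeg (+ 1) (ℤ.+≤+ a≤b))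

  m/n*n≡m : ∀ m n .{{_ : ℕ.NonZero n}} → (+ m / n) * ℕ→ℚ n ≡ ℕ→ℚ m
  m/n*n≡m m n@(suc k) = toℚᵘ-injective (begin
    toℚᵘ ((+ m / n) * ℕ→ℚ n)                  ≈⟨ toℚᵘ-homo-* (+ m / n) (ℕ→ℚ n) ⟩
    toℚᵘ (+ m / n) ℚᵘ.* toℚᵘ (ℕ→ℚ n)          ≈⟨ ℚᵘ.*-cong (toℚᵘ-fromℚᵘ (ℚᵘ.mkℚᵘ (+ m) k))
                                                              (toℚᵘ-fromℚᵘ (ℚᵘ.mkℚᵘ (+ n) 0)) ⟩
    ℚᵘ.mkℚᵘ (+ m) k ℚᵘ.* ℚᵘ.mkℚᵘ (+ n) 0      ≈⟨ ℚᵘ.*≡* (trans (ℤ.*-identityʳ _)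
                                                  (cong (λ j → + m ℤ.* + j) (sym (ℕ.*-identityʳ n)))) ⟩
    ℚᵘ.mkℚᵘ (+ m) 0                           ≈⟨ toℚᵘ-fromℚᵘ (ℚᵘ.mkℚᵘ (+ m) 0) ⟨
    toℚᵘ (ℕ→ℚ m)                              ∎)
    where open ℚᵘ.≃-Reasoning

  -- The hypothesis d ≡ 0 → a ≡ 0 is needed because avgFrom a 0 is 0 whatever a is.
  avgFrom≤⇒≤* : ∀ {a d} t → (d ≡ 0 → a ≡ 0) → avgFrom a d ≤ t → ℕ→ℚ a ≤ t * ℕ→ℚ d
  avgFrom≤⇒≤* {d = zero} t isolated _ rewrite isolated refl = ≤-reflexive (sym (*-zeroʳ t))
  avgFrom≤⇒≤* {a} {suc d} t _ avg≤t = begin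
    ℕ→ℚ a                          ≡⟨ m/n*n≡m a (suc d) ⟨
    (+ a / suc d) * ℕ→ℚ (suc d)    ≤⟨ *-monoʳ-≤-nonNeg (ℕ→ℚ (suc d)) {{normalize-nonNeg (suc d) 1}} avg≤t ⟩
    t * ℕ→ℚ (suc d)                ∎
    where open ≤-Reasoning

  p+p≤q+q⇒p≤q : ∀ {p q} → p + p ≤ q + q → p ≤ q
  p+p≤q+q⇒p≤q p+p≤q+q = ≮⇒≥ (λ q<p → <-irrefl refl (≤-<-trans p+p≤q+q (+-mono-<-≤ q<p (<⇒≤ q<p))))

  scaled-≤-+ : ∀ t {a a′ b b′} → ℕ→ℚ a ≤ t * ℕ→ℚ a′ → ℕ→ℚ b ≤ t * ℕ→ℚ b′ →
               ℕ→ℚ (a ℕ.+ b) ≤ t * ℕ→ℚ (a′ ℕ.+ b′)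
  scaled-≤-+ t {a} {a′} {b} {b′} a≤ b≤ = begin
    ℕ→ℚ (a ℕ.+ b)                  ≡⟨ ℕ→ℚ-+ a b ⟩
    ℕ→ℚ a + ℕ→ℚ b                  ≤⟨ +-mono-≤ a≤ b≤ ⟩
    t * ℕ→ℚ a′ + t * ℕ→ℚ b′        ≡⟨ *-distribˡ-+ t (ℕ→ℚ a′) (ℕ→ℚ b′) ⟨
    t * (ℕ→ℚ a′ + ℕ→ℚ b′)          ≡⟨ cong (t *_) (ℕ→ℚ-+ a′ b′) ⟨
    t * ℕ→ℚ (a′ ℕ.+ b′)            ∎
    where open ≤-Reasoning

  scaled-≤-halve : ∀ t {a b} → ℕ→ℚ (a ℕ.+ a) ≤ t * ℕ→ℚ (b ℕ.+ b) → ℕ→ℚ a ≤ t * ℕ→ℚ b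
  scaled-≤-halve t {a} {b} a+a≤ = p+p≤q+q⇒p≤q (subst₂ _≤_ (ℕ→ℚ-+ a a)
    (trans (cong (t *_) (ℕ→ℚ-+ b b)) (*-distribˡ-+ t (ℕ→ℚ b) (ℕ→ℚ b))) a+a≤)

  complement-bound : ∀ {s τ e} t → s ℕ.+ τ ≡ e → ℕ→ℚ e ≤ t * ℕ→ℚ τ → ℕ→ℚ s * t ≤ (t - 1ℚ) * ℕ→ℚ e
  complement-bound {s} {τ} t refl e≤tτ = begin
    S * t                           ≡⟨ add-and-subtract ⟩
    (S + T) + (S * t - (S + T))     ≤⟨ +-monoˡ-≤ (S * t - (S + T)) (subst (_≤ t * T) (ℕ→ℚ-+ s τ) e≤tτ) ⟩
    t * T + (S * t - (S + T))       ≡⟨ collect ⟩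
    (t - 1ℚ) * (S + T)              ≡⟨ cong ((t - 1ℚ) *_) (ℕ→ℚ-+ s τ) ⟨
    (t - 1ℚ) * ℕ→ℚ (s ℕ.+ τ)        ∎
    where
    open ≤-Reasoning
    open +-*-Solver using (solve; _:+_; _:*_; _:-_; _:=_; con)
    S T : ℚ
    S = ℕ→ℚ s
    T = ℕ→ℚ τ
    add-and-subtract : S * t ≡ (S + T) + (S * t - (S + T))
    add-and-subtract = solve 3 (λ S T t → S :* t := (S :+ T) :+ (S :* t :- (S :+ T))) refl S T t
    collect : t * T + (S * t - (S + T)) ≡ (t - 1ℚ) * (S + T)
    collect = solve 3 (λ S T t → t :* T :+ (S :* t :- (S :+ T)) := (t :- con 1ℚ) :* (S :+ T)) refl S T t

module Counting where

  open import Data.Bool using (Bool; true; false; _∧_; _∨_; not; if_then_else_)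
  open import Data.Bool.Properties
    using (∧-distribˡ-∨; ∧-conicalʳ; ∧-identityʳ; ∧-zeroʳ; ∨-identityʳ; ∨-zeroʳ)
  open import Data.Empty using (⊥; ⊥-elim)
  open import Data.Fin using (Fin; zero; suc; punchIn; _<?_)
  open import Data.Fin.Properties using (punchInᵢ≢i; <-asym; <-cmp)
  open import Data.List.Properties using (map-tabulate)
  open import Data.Nat using (zero; suc; _+_; _≤_; _<_; z≤n)
  open import Data.Nat.ListAction using () renaming (sum to sumᴸ)
  import Data.Nat.Properties
  open import Data.Nat.Properties
    using (+-0-commutativeMonoid; +-identityʳ; +-mono-≤; +-mono-<-≤; m≤m+n; ≤-refl; ≤-reflexive; ≤-trans)
  open import Algebra.Properties.CommutativeMonoid.Sum +-0-commutativeMonoid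
    using (sum-syntax; sum-cong-≗; sum-replicate-zero; sum-remove; ∑-distrib-+; ∑-comm)
  open import Data.Sum using (_⊎_; inj₁; inj₂)
  open import Function using (_∘_; id; case_of_)
  open import Relation.Binary.Definitions using (tri<; tri≈; tri>)
  open import Relation.Binary.PropositionalEquality
  open import Relation.Nullary using (yes; no; contradiction)
  open import Relation.Nullary.Decidable using (⌊_⌋)

  ∨-true⁻ : ∀ a {b} → a ∨ b ≡ true → a ≡ true ⊎ b ≡ true
  ∨-true⁻ true  _ = inj₁ refl
  ∨-true⁻ false b = inj₂ b

  ∨-introˡ : ∀ {a} b → a ≡ true → a ∨ b ≡ true
  ∨-introˡ b refl = refl

  ∨-introʳ : ∀ a {b} → b ≡ true → a ∨ b ≡ true
  ∨-introʳ true  _ = refl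
  ∨-introʳ false b = b

  ⟦_⟧ : Bool → ℕ
  ⟦ b ⟧ = if b then 1 else 0

  ⟦⟧-mono : ∀ {a b} → (a ≡ true → b ≡ true) → ⟦ a ⟧ ≤ ⟦ b ⟧
  ⟦⟧-mono {false} a⇒b = z≤n
  ⟦⟧-mono {true}  a⇒b rewrite a⇒b refl = ≤-refl

  ⟦∨⟧-≤ : ∀ a b → ⟦ a ∨ b ⟧ ≤ ⟦ a ⟧ + ⟦ b ⟧
  ⟦∨⟧-≤ false b = ≤-refl
  ⟦∨⟧-≤ true  b = m≤m+n 1 ⟦ b ⟧

  ⟦∨⟧-disjoint : ∀ a b → (a ≡ true → b ≡ true → ⊥) → ⟦ a ∨ b ⟧ ≡ ⟦ a ⟧ + ⟦ b ⟧
  ⟦∨⟧-disjoint false b     _        = refl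
  ⟦∨⟧-disjoint true  false _        = refl
  ⟦∨⟧-disjoint true  true  disjoint = ⊥-elim (disjoint refl refl)

  Σv≡∑ : ∀ {n} (f : Fin n → ℕ) → Σv f ≡ ∑[ i < n ] f i
  Σv≡∑ {zero}  f = refl
  Σv≡∑ {suc n} f = cong (f zero +_) (trans
    (cong sumᴸ (trans (map-tabulate suc f) (sym (map-tabulate id (f ∘ suc)))))
    (Σv≡∑ (f ∘ suc)))

  ∑-mono-≤ : ∀ {n} {f g : Fin n → ℕ} → (∀ i → f i ≤ g i) → ∑[ i < n ] f i ≤ ∑[ i < n ] g i
  ∑-mono-≤ {zero}  f≤g = z≤n
  ∑-mono-≤ {suc n} f≤g = +-mono-≤ (f≤g zero) (∑-mono-≤ (f≤g ∘ suc))

  ∑-mono-< : ∀ {n} {f g : Fin n → ℕ} c → (∀ i → f i ≤ g i) → f c < g c →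
             ∑[ i < n ] f i < ∑[ i < n ] g i
  ∑-mono-< {suc n} {f} {g} c f≤g fc<gc = begin-strict
    ∑[ i < suc n ] f i                  ≡⟨ sum-remove f ⟩
    f c + ∑[ i < n ] f (punchIn c i)    <⟨ +-mono-<-≤ fc<gc (∑-mono-≤ (f≤g ∘ punchIn c)) ⟩
    g c + ∑[ i < n ] g (punchIn c i)    ≡⟨ sum-remove g ⟨
    ∑[ i < suc n ] g i                  ∎
    where open Data.Nat.Properties.≤-Reasoning

  term≤∑ : ∀ {n} (f : Fin n → ℕ) c → f c ≤ ∑[ i < n ] f i
  term≤∑ {suc n} f c = ≤-trans (m≤m+n (f c) _) (≤-reflexive (sym (sum-remove f)))

  ∑-single : ∀ {n} (f : Fin n → ℕ) c → (∀ i → i ≢ c → f i ≡ 0) → ∑[ i < n ] f i ≡ f c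
  ∑-single {suc n} f c vanish = begin
    ∑[ i < suc n ] f i                  ≡⟨ sum-remove f ⟩
    f c + ∑[ i < n ] f (punchIn c i)    ≡⟨ cong (f c +_) (sum-cong-≗ (λ i → vanish _ (punchInᵢ≢i c i))) ⟩
    f c + ∑[ i < n ] 0                  ≡⟨ cong (f c +_) (sum-replicate-zero n) ⟩
    f c + 0                             ≡⟨ +-identityʳ (f c) ⟩
    f c                                 ∎
    where open ≡-Reasoning

  ∑-⟦∧⟧ : ∀ {n} b (f : Fin n → Bool) → ∑[ j < n ] ⟦ b ∧ f j ⟧ ≡ (if b then ∑[ j < n ] ⟦ f j ⟧ else 0)
  ∑-⟦∧⟧     true  f = refl
  ∑-⟦∧⟧ {n} false f = sum-replicate-zero n

  module _ {n : ℕ} where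

    infixr 6 _∪ₚ_
    infix  7 _∖ₚ_
    infix  8 _ᵀ

    _∪ₚ_ : PairSet n → PairSet n → PairSet n
    (R ∪ₚ Q) i j = R i j ∨ Q i j

    _∖ₚ_ : PairSet n → PairSet n → PairSet n
    (R ∖ₚ Q) i j = R i j ∧ not (Q i j)

    _ᵀ : PairSet n → PairSet n
    (R ᵀ) i j = R j i

    undirected : PairSet n → PairSet n
    undirected D = D ∪ₚ D ᵀ

    Disjointₚ : PairSet n → PairSet n → Set
    Disjointₚ R Q = ∀ i j → R i j ≡ true → Q i j ≡ true → ⊥

    arcs : PairSet n → ℕ
    arcs R = ∑[ i < n ] ∑[ j < n ] ⟦ R i j ⟧

    arcs-cong : ∀ {R Q} → (∀ i j → R i j ≡ Q i j) → arcs R ≡ arcs Q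
    arcs-cong R≗Q = sum-cong-≗ (λ i → sum-cong-≗ (λ j → cong ⟦_⟧ (R≗Q i j)))

    arcs-mono : ∀ {R Q} → R ⊆ₚ Q → arcs R ≤ arcs Q
    arcs-mono R⊆Q = ∑-mono-≤ (λ i → ∑-mono-≤ (λ j → ⟦⟧-mono (R⊆Q i j)))

    arcs-∅ : ∀ {R} → (∀ i j → R i j ≡ false) → arcs R ≡ 0
    arcs-∅ R≡∅ = trans (sum-cong-≗ (λ i → trans (sum-cong-≗ (λ j → cong ⟦_⟧ (R≡∅ i j)))
                                                (sum-replicate-zero n)))
                       (sum-replicate-zero n)

    ∑∑-distrib-+ : ∀ (f g : Fin n → Fin n → ℕ) →
                   ∑[ i < n ] ∑[ j < n ] (f i j + g i j) ≡
                   ∑[ i < n ] ∑[ j < n ] f i j + ∑[ i < n ] ∑[ j < n ] g i j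
    ∑∑-distrib-+ f g = trans (sum-cong-≗ (λ i → ∑-distrib-+ (f i) (g i)))
                             (∑-distrib-+ (λ i → ∑[ j < n ] f i j) (λ i → ∑[ j < n ] g i j))

    arcs-∪-≤ : ∀ R Q → arcs (R ∪ₚ Q) ≤ arcs R + arcs Q
    arcs-∪-≤ R Q = ≤-trans (∑-mono-≤ (λ i → ∑-mono-≤ (λ j → ⟦∨⟧-≤ (R i j) (Q i j))))
                           (≤-reflexive (∑∑-distrib-+ (λ i j → ⟦ R i j ⟧) (λ i j → ⟦ Q i j ⟧)))

    arcs-∪ : ∀ {R Q} → Disjointₚ R Q → arcs (R ∪ₚ Q) ≡ arcs R + arcs Q
    arcs-∪ {R} {Q} disjoint =
      trans (sum-cong-≗ (λ i → sum-cong-≗ (λ j → ⟦∨⟧-disjoint (R i j) (Q i j) (disjoint i j))))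
            (∑∑-distrib-+ (λ i j → ⟦ R i j ⟧) (λ i j → ⟦ Q i j ⟧))

    arcs-ᵀ : ∀ R → arcs (R ᵀ) ≡ arcs R
    arcs-ᵀ R = ∑-comm (λ j i → ⟦ R i j ⟧)

    upper : PairSet n → PairSet n
    upper R i j = ⌊ i <? j ⌋ ∧ R i j

    upper-⊆ : ∀ {R} i j → upper R i j ≡ true → R i j ≡ true
    upper-⊆ {R} i j = ∧-conicalʳ ⌊ i <? j ⌋ (R i j)

    upper-∪ : ∀ R Q i j → upper (R ∪ₚ Q) i j ≡ (upper R ∪ₚ upper Q) i j
    upper-∪ R Q i j = ∧-distribˡ-∨ ⌊ i <? j ⌋ (R i j) (Q i j)

    upper-asym : ∀ R → Disjointₚ (upper R) (upper R ᵀ)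
    upper-asym R i j i<j∧R j<i∧R with i <? j | j <? i
    ... | yes i<j | yes j<i = <-asym i<j j<i
    ... | no _    | _       = case i<j∧R of λ ()
    ... | yes _   | no _    = case j<i∧R of λ ()

    ≗upper∪upperᵀ : ∀ {R} → (∀ i j → R i j ≡ R j i) → (∀ i → R i i ≡ false) →
                    ∀ i j → R i j ≡ (upper R ∪ₚ upper R ᵀ) i j
    ≗upper∪upperᵀ {R} R-sym R-irrefl i j with i <? j | j <? i
    ... | yes i<j | yes j<i = ⊥-elim (<-asym i<j j<i)
    ... | yes _   | no _    = sym (∨-identityʳ (R i j))
    ... | no _    | yes _   = R-sym i j
    ... | no i≮j  | no j≮i  with <-cmp i j
    ...   | tri< i<j _ _  = ⊥-elim (i≮j i<j)
    ...   | tri> _ _ j<i  = ⊥-elim (j≮i j<i)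
    ...   | tri≈ _ refl _ = R-irrefl i

    ∣∣ₚ≡arcs-upper : ∀ R → ∣ R ∣ₚ ≡ arcs (upper R)
    ∣∣ₚ≡arcs-upper R = trans (Σv≡∑ (λ i → Σv (λ j → ⟦ upper R i j ⟧)))
                             (sum-cong-≗ (λ i → Σv≡∑ (λ j → ⟦ upper R i j ⟧)))

    ∣∣ₚ-cong : ∀ {R Q} → (∀ i j → R i j ≡ Q i j) → ∣ R ∣ₚ ≡ ∣ Q ∣ₚ
    ∣∣ₚ-cong {R} {Q} R≗Q = begin
      ∣ R ∣ₚ             ≡⟨ ∣∣ₚ≡arcs-upper R ⟩
      arcs (upper R)     ≡⟨ arcs-cong (λ i j → cong (⌊ i <? j ⌋ ∧_) (R≗Q i j)) ⟩
      arcs (upper Q)     ≡⟨ ∣∣ₚ≡arcs-upper Q ⟨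
      ∣ Q ∣ₚ             ∎
      where open ≡-Reasoning

    ∣∣ₚ-∪ : ∀ {R Q} → Disjointₚ R Q → ∣ R ∪ₚ Q ∣ₚ ≡ ∣ R ∣ₚ + ∣ Q ∣ₚ
    ∣∣ₚ-∪ {R} {Q} disjoint = begin
      ∣ R ∪ₚ Q ∣ₚ                         ≡⟨ ∣∣ₚ≡arcs-upper (R ∪ₚ Q) ⟩
      arcs (upper (R ∪ₚ Q))               ≡⟨ arcs-cong (upper-∪ R Q) ⟩
      arcs (upper R ∪ₚ upper Q)           ≡⟨ arcs-∪ upper-disjoint ⟩
      arcs (upper R) + arcs (upper Q)     ≡⟨ cong₂ _+_ (∣∣ₚ≡arcs-upper R) (∣∣ₚ≡arcs-upper Q) ⟨
      ∣ R ∣ₚ + ∣ Q ∣ₚ                     ∎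
      where
      open ≡-Reasoning
      upper-disjoint : Disjointₚ (upper R) (upper Q)
      upper-disjoint i j r q = disjoint i j (upper-⊆ {R} i j r) (upper-⊆ {Q} i j q)

    ∣∣ₚ-∖-split : ∀ {R Q} → Q ⊆ₚ R → ∣ R ∖ₚ Q ∣ₚ + ∣ Q ∣ₚ ≡ ∣ R ∣ₚ
    ∣∣ₚ-∖-split {R} {Q} Q⊆R = sym (trans (∣∣ₚ-cong split) (∣∣ₚ-∪ disjoint))
      where
      split : ∀ i j → R i j ≡ ((R ∖ₚ Q) ∪ₚ Q) i j
      split i j with Q i j in q
      ... | true  = trans (Q⊆R i j q) (sym (∨-zeroʳ _))
      ... | false = sym (trans (∨-identityʳ _) (∧-identityʳ (R i j)))
      disjoint : Disjointₚ (R ∖ₚ Q) Q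
      disjoint i j r∖q q rewrite q = contradiction (trans (sym r∖q) (∧-zeroʳ (R i j))) λ ()

    arcs≡∣∣ₚ+∣∣ₚ : ∀ {R} → (∀ i j → R i j ≡ R j i) → (∀ i → R i i ≡ false) → arcs R ≡ ∣ R ∣ₚ + ∣ R ∣ₚ
    arcs≡∣∣ₚ+∣∣ₚ {R} R-sym R-irrefl = begin
      arcs R                               ≡⟨ arcs-cong (≗upper∪upperᵀ R-sym R-irrefl) ⟩
      arcs (upper R ∪ₚ upper R ᵀ)          ≡⟨ arcs-∪ (upper-asym R) ⟩
      arcs (upper R) + arcs (upper R ᵀ)    ≡⟨ cong (arcs (upper R) +_) (arcs-ᵀ (upper R)) ⟩
      arcs (upper R) + arcs (upper R)      ≡⟨ cong₂ _+_ (∣∣ₚ≡arcs-upper R) (∣∣ₚ≡arcs-upper R) ⟨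
      ∣ R ∣ₚ + ∣ R ∣ₚ                      ∎
      where open ≡-Reasoning

module Forcing {n : ℕ} (G : Graph n) where

  open Counting
  open import Data.Bool using (true; false; _∧_; not)
  open import Data.Bool.Properties using (∧-conicalˡ; ∧-conicalʳ; ∨-comm; not-¬; ¬-not)
  open import Data.Empty using (⊥; ⊥-elim)
  open import Data.Fin using (Fin)
  open import Data.Nat using (_<_)
  open import Data.Nat.Induction using (<-wellFounded)
  open import Data.Product using (_×_; _,_; proj₁; proj₂)
  open import Data.Sum using (_⊎_; inj₁; inj₂)
  open import Induction.WellFounded using (Acc; acc)
  open import Relation.Binary.PropositionalEquality
  open import Relation.Nullary using (contradiction)

  module _ {M : PairSet n} (pm : IsPerfectMatching G M) where

    partner : Fin n → Fin n
    partner i = proj₁ (proj₂ pm i)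

    partner-matched : ∀ i → M i (partner i) ≡ true
    partner-matched i = proj₁ (proj₂ (proj₂ pm i))

    partner-unique : ∀ {i j} → M i j ≡ true → j ≡ partner i
    partner-unique {i} {j} = proj₂ (proj₂ (proj₂ pm i)) j

    matched-sym : ∀ {i j} → M i j ≡ true → M j i ≡ true
    matched-sym {i} {j} = trans (proj₁ (proj₁ pm) j i)

    unmatched-sym : ∀ {i j} → M i j ≡ false → M j i ≡ false
    unmatched-sym {i} {j} = trans (proj₁ (proj₁ pm) j i)

    matched⇒adj : ∀ {i j} → M i j ≡ true → adj G i j ≡ true
    matched⇒adj {i} {j} = proj₂ (proj₁ pm) i j

  perfectMatching-⊆⇒≡ : ∀ {M M′} → IsPerfectMatching G M → IsPerfectMatching G M′ → M ⊆ₚ M′ →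
                         ∀ i j → M′ i j ≡ M i j
  perfectMatching-⊆⇒≡ {M} {M′} pm pm′ M⊆M′ i j with M i j in Mij
  ... | true  = M⊆M′ i j Mij
  ... | false = ¬-not λ M′ij →
    not-¬ (subst (λ k → M i k ≡ true) (sym (j≡partner M′ij)) (partner-matched pm i)) Mij
    where
    j≡partner : M′ i j ≡ true → j ≡ partner pm i
    j≡partner M′ij = trans (partner-unique pm′ M′ij)
                           (sym (partner-unique pm′ (M⊆M′ i (partner pm i) (partner-matched pm i))))

  -- D c x ≡ true says that cx is an edge of the star centred at c, and rank c is the step at
  -- which that star was chosen.
  EarlierArc : PairSet n → (Fin n → ℕ) → Fin n → Fin n → Fin n → Set
  EarlierArc D rank c y z = (D y z ≡ true × rank y < rank c) ⊎ (D z y ≡ true × rank z < rank c)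

  NestedStars : PairSet n → (Fin n → ℕ) → Set
  NestedStars D rank = ∀ {c x y z} → D c x ≡ true → adj G c y ≡ true → z ≢ c →
                       undirected D y z ≡ true → EarlierArc D rank c y z

  module _ {D : PairSet n} {rank : Fin n → ℕ} (nested : NestedStars D rank)
           {M M′ : PairSet n} (pm : IsPerfectMatching G M) (pm′ : IsPerfectMatching G M′)
           (agree : ((adj G ∖ₚ undirected D) ∩ₚ M) ⊆ₚ M′) where

    unforced⇒undirected : ∀ {i j} → M i j ≡ true → M′ i j ≡ false → undirected D i j ≡ true
    unforced⇒undirected {i} {j} Mij M′ij with undirected D i j in Tij
    ... | true  = refl
    ... | false = contradiction
      (agree i j (cong₂ _∧_ (cong₂ _∧_ (matched⇒adj pm Mij) (cong not Tij)) Mij))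
      (not-¬ M′ij)

    no-unforced-arc : ∀ c → Acc _<_ (rank c) → ∀ {x} → D c x ≡ true → M c x ≡ true → M′ c x ≡ false → ⊥
    no-unforced-arc c (acc earlier) {x} Dcx Mcx M′cx =
      descend (nested Dcx c~y z≢c (unforced⇒undirected Myz M′yz))
      where
      y z : Fin n
      y = partner pm′ c
      z = partner pm y
      Myz : M y z ≡ true
      Myz = partner-matched pm y
      c~y : adj G c y ≡ true
      c~y = matched⇒adj pm′ (partner-matched pm′ c)
      z≢c : z ≢ c
      z≢c z≡c = not-¬ (subst (λ w → M′ c w ≡ true) y≡x (partner-matched pm′ c)) M′cx
        where
        y≡x : y ≡ x
        y≡x = trans (partner-unique pm (matched-sym pm (subst (λ w → M y w ≡ true) z≡c Myz)))
                    (sym (partner-unique pm Mcx))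
      M′yz : M′ y z ≡ false
      M′yz = ¬-not λ M′yz → z≢c (trans (partner-unique pm′ M′yz)
                                       (sym (partner-unique pm′ (matched-sym pm′ (partner-matched pm′ c)))))
      descend : EarlierArc D rank c y z → ⊥
      descend (inj₁ (Dyz , y<c)) = no-unforced-arc y (earlier y<c) Dyz Myz M′yz
      descend (inj₂ (Dzy , z<c)) =
        no-unforced-arc z (earlier z<c) Dzy (matched-sym pm Myz) (unmatched-sym pm′ M′yz)

    matching⊆matching : M ⊆ₚ M′
    matching⊆matching i j Mij with M′ i j in M′ij
    ... | true  = refl
    ... | false with ∨-true⁻ (D i j) (unforced⇒undirected Mij M′ij)
    ...   | inj₁ Dij = ⊥-elim (no-unforced-arc i (<-wellFounded _) Dij Mij M′ij)
    ...   | inj₂ Dji =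
      ⊥-elim (no-unforced-arc j (<-wellFounded _) Dji (matched-sym pm Mij) (unmatched-sym pm′ M′ij))

  undirected⊆adj : ∀ {D} → D ⊆ₚ adj G → undirected D ⊆ₚ adj G
  undirected⊆adj {D} D⊆E i j T with ∨-true⁻ (D i j) T
  ... | inj₁ Dij = D⊆E i j Dij
  ... | inj₂ Dji = trans (adj-sym G i j) (D⊆E j i Dji)

  undirected-complement-isCompleteForcingSet : ∀ {D rank} → NestedStars D rank →
                                               IsCompleteForcingSet G (adj G ∖ₚ undirected D)
  undirected-complement-isCompleteForcingSet {D} nested = isEdgeSet , forcing
    where
    isEdgeSet : IsEdgeSet G (adj G ∖ₚ undirected D)
    isEdgeSet = (λ i j → cong₂ _∧_ (adj-sym G i j) (cong not (∨-comm (D i j) (D j i))))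
              , (λ i j → ∧-conicalˡ (adj G i j) _)
    forcing : ∀ M → IsPerfectMatching G M → IsForcingSet G M ((adj G ∖ₚ undirected D) ∩ₚ M)
    forcing M pm = (λ i j → ∧-conicalʳ _ (M i j))
                 , λ M′ pm′ agree → perfectMatching-⊆⇒≡ pm pm′ (matching⊆matching nested pm pm′ agree)

module Neighbourhoods {n : ℕ} (G : Graph n) where

  open Counting
  open import Algebra.Bundles using (CommutativeMonoid)
  open import Data.Bool using (Bool; true; false; _∧_; _∨_; not; if_then_else_)
  open import Data.Bool.Properties using (∨-commutativeMonoid; ∨-comm; ∨-zeroʳ; ∧-conicalʳ; not-¬; ¬-not)
  open import Algebra.Properties.CommutativeSemigroup
    (CommutativeMonoid.commutativeSemigroup ∨-commutativeMonoid) using (interchange)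
  open import Data.Nat.Properties using (+-0-commutativeMonoid; +-monoʳ-≤; n≤0⇒n≡0)
  open import Algebra.Properties.CommutativeMonoid.Sum +-0-commutativeMonoid
    using (sum-syntax; sum-cong-≗; sum-replicate-zero)
  open import Data.Fin using (Fin; _≟_)
  open import Data.Nat using (_+_; _≤_; _<_; z≤n; s≤s)
  open import Data.Product using (_×_; _,_; proj₁; proj₂)
  open import Data.Sum using (inj₁; inj₂)
  open import Function using (_∘_; case_of_)
  open import Relation.Binary.PropositionalEquality
  open import Relation.Nullary using (yes; no; does; contradiction)
  open import Relation.Nullary.Decidable using (dec-true; dec-false)

  nbhdIn : (Fin n → Bool) → Fin n → Fin n → Bool
  nbhdIn U c u = U u ∧ adj G c u

  induced : (Fin n → Bool) → PairSet n
  induced U i j = U i ∧ nbhdIn U i j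

  star : (Fin n → Bool) → Fin n → PairSet n
  star U c x y = does (x ≟ c) ∧ nbhdIn U c y

  twoWalks : (Fin n → Bool) → Fin n → PairSet n
  twoWalks U c u w = nbhdIn U c u ∧ nbhdIn U u w

  deleteClosedNbhd : Fin n → (Fin n → Bool) → Fin n → Bool
  deleteClosedNbhd c U i = U i ∧ not (does (i ≟ c) ∨ adj G c i)

  size : (Fin n → Bool) → ℕ
  size U = ∑[ i < n ] ⟦ U i ⟧

  degIn≡∑ : ∀ U c → degIn G U c ≡ ∑[ u < n ] ⟦ nbhdIn U c u ⟧
  degIn≡∑ U c = Σv≡∑ (λ u → ⟦ nbhdIn U c u ⟧)

  degIn≡arcs-star : ∀ U c → degIn G U c ≡ arcs (star U c)
  degIn≡arcs-star U c = sym (begin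
    arcs (star U c)                              ≡⟨ sum-cong-≗ (λ x → ∑-⟦∧⟧ (does (x ≟ c)) (nbhdIn U c)) ⟩
    ∑[ x < n ] (if does (x ≟ c) then d else 0)   ≡⟨ ∑-single _ c others-vanish ⟩
    (if does (c ≟ c) then d else 0)              ≡⟨ cong (if_then d else 0) (dec-true (c ≟ c) refl) ⟩
    d                                            ≡⟨ degIn≡∑ U c ⟨
    degIn G U c                                  ∎)
    where
    open ≡-Reasoning
    d : ℕ
    d = ∑[ u < n ] ⟦ nbhdIn U c u ⟧
    others-vanish : ∀ x → x ≢ c → (if does (x ≟ c) then d else 0) ≡ 0
    others-vanish x x≢c = cong (if_then d else 0) (dec-false (x ≟ c) x≢c)

  twoDegIn≡arcs-twoWalks : ∀ U c → twoDegIn G U c ≡ arcs (twoWalks U c)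
  twoDegIn≡arcs-twoWalks U c = trans (Σv≡∑ (λ u → if nbhdIn U c u then degIn G U u else 0))
    (sum-cong-≗ (λ u → trans (cong (if nbhdIn U c u then_else 0) (degIn≡∑ U u))
                             (sym (∑-⟦∧⟧ (nbhdIn U c u) (nbhdIn U u)))))

  degIn≡0⇒twoDegIn≡0 : ∀ U c → degIn G U c ≡ 0 → twoDegIn G U c ≡ 0
  degIn≡0⇒twoDegIn≡0 U c deg≡0 =
    trans (Σv≡∑ (λ u → if nbhdIn U c u then degIn G U u else 0))
          (trans (sum-cong-≗ no-neighbour) (sum-replicate-zero n))
    where
    no-neighbour : ∀ u → (if nbhdIn U c u then degIn G U u else 0) ≡ 0
    no-neighbour u with nbhdIn U c u in c~u
    ... | false = refl
    ... | true  = case n≤0⇒n≡0 (subst₂ _≤_ (cong ⟦_⟧ c~u) (trans (sym (degIn≡∑ U c)) deg≡0)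
                                       (term≤∑ (λ v → ⟦ nbhdIn U c v ⟧) u)) of λ ()

  deleteClosedNbhd⁻ : ∀ c U {i} → deleteClosedNbhd c U i ≡ true → U i ≡ true × i ≢ c × adj G c i ≡ false
  deleteClosedNbhd⁻ c U {i} kept with U i | i ≟ c | adj G c i
  ... | true | no i≢c | false = refl , i≢c , refl

  size-deleteClosedNbhd : ∀ {c U} → U c ≡ true → size (deleteClosedNbhd c U) < size U
  size-deleteClosedNbhd {c} {U} Uc = ∑-mono-< c (λ i → ⟦⟧-mono (proj₁ ∘ deleteClosedNbhd⁻ c U))
    (subst₂ (λ a b → ⟦ a ⟧ < ⟦ b ⟧) (sym c-deleted) (sym Uc) (s≤s z≤n))
    where
    c-deleted : deleteClosedNbhd c U c ≡ false
    c-deleted = ¬-not (λ kept → proj₁ (proj₂ (deleteClosedNbhd⁻ c U kept)) refl)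

  -- An edge of G[U] that disappears with N[c] has an endpoint in N(c), so it is the second
  -- edge of a walk of length two from c.
  induced-cover : ∀ U c i j → induced U i j ≡ true →
                  (induced (deleteClosedNbhd c U) ∪ₚ (twoWalks U c ∪ₚ twoWalks U c ᵀ)) i j ≡ true
  induced-cover U c i j e
    with U i | U j | adj G i j in i~j | adj G c i in c~i | adj G c j in c~j | i ≟ c | j ≟ c
  ... | true | true | true | true  | _     | _        | _        = ∨-zeroʳ _
  ... | true | true | true | false | true  | _        | _        rewrite adj-sym G j i | i~j = ∨-zeroʳ _
  ... | true | true | true | false | false | no _     | no _     = refl
  ... | true | true | true | false | false | yes refl | _        = contradiction i~j (not-¬ c~j)
  ... | true | true | true | false | false | no _     | yes refl =
    contradiction (trans (adj-sym G j i) i~j) (not-¬ c~i)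

  arcs-induced-deleteClosedNbhd : ∀ U c →
    arcs (induced U) ≤ arcs (induced (deleteClosedNbhd c U)) + (twoDegIn G U c + twoDegIn G U c)
  arcs-induced-deleteClosedNbhd U c = begin
    arcs (induced U)                        ≤⟨ arcs-mono (induced-cover U c) ⟩
    arcs (induced U′ ∪ₚ (W ∪ₚ W ᵀ))         ≤⟨ arcs-∪-≤ (induced U′) (W ∪ₚ W ᵀ) ⟩
    kept + arcs (W ∪ₚ W ᵀ)                  ≤⟨ +-monoʳ-≤ kept (arcs-∪-≤ W (W ᵀ)) ⟩
    kept + (arcs W + arcs (W ᵀ))            ≡⟨ cong (λ w → kept + (arcs W + w)) (arcs-ᵀ W) ⟩
    kept + (arcs W + arcs W)                ≡⟨ cong (λ w → kept + (w + w)) (twoDegIn≡arcs-twoWalks U c) ⟨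
    kept + (twoDegIn G U c + twoDegIn G U c) ∎
    where
    open Data.Nat.Properties.≤-Reasoning
    U′ : Fin n → Bool
    U′ = deleteClosedNbhd c U
    W : PairSet n
    W = twoWalks U c
    kept : ℕ
    kept = arcs (induced U′)

  star⁻ : ∀ U c x y → star U c x y ≡ true → x ≡ c × nbhdIn U c y ≡ true
  star⁻ U c x y s with x ≟ c
  ... | yes x≡c = x≡c , s

  star-asym : ∀ U c → Disjointₚ (star U c) (star U c ᵀ)
  star-asym U c x y sxy syx with star⁻ U c x y sxy | star⁻ U c y x syx
  ... | refl , c~y | refl , _ = not-¬ (adj-irrefl G x) (∧-conicalʳ (U x) _ c~y)

  arcs-undirected-star-∪ : ∀ U c {D} → (∀ {i j} → D i j ≡ true → i ≢ c × j ≢ c) →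
    arcs (undirected (star U c ∪ₚ D)) ≡ arcs (undirected D) + (degIn G U c + degIn G U c)
  arcs-undirected-star-∪ U c {D} avoids-c = begin
    arcs (undirected (S ∪ₚ D))             ≡⟨ arcs-cong regroup ⟩
    arcs (undirected D ∪ₚ undirected S)    ≡⟨ arcs-∪ disjoint ⟩
    old + arcs (S ∪ₚ S ᵀ)                  ≡⟨ cong (old +_) (arcs-∪ (star-asym U c)) ⟩
    old + (arcs S + arcs (S ᵀ))            ≡⟨ cong (λ s → old + (arcs S + s)) (arcs-ᵀ S) ⟩
    old + (arcs S + arcs S)                ≡⟨ cong (λ s → old + (s + s)) (degIn≡arcs-star U c) ⟨
    old + (degIn G U c + degIn G U c)      ∎
    where
    open ≡-Reasoning
    S : PairSet n
    S = star U c
    old : ℕ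
    old = arcs (undirected D)
    regroup : ∀ i j → undirected (S ∪ₚ D) i j ≡ (undirected D ∪ₚ undirected S) i j
    regroup i j = trans (interchange (S i j) (D i j) (S j i) (D j i))
                        (∨-comm (S i j ∨ S j i) (D i j ∨ D j i))
    disjoint : Disjointₚ (undirected D) (undirected S)
    disjoint i j Tij Sij with ∨-true⁻ (D i j) Tij | ∨-true⁻ (S i j) Sij
    ... | inj₁ Dij | inj₁ Sij = proj₁ (avoids-c Dij) (proj₁ (star⁻ U c i j Sij))
    ... | inj₁ Dij | inj₂ Sji = proj₂ (avoids-c Dij) (proj₁ (star⁻ U c j i Sji))
    ... | inj₂ Dji | inj₁ Sij = proj₂ (avoids-c Dji) (proj₁ (star⁻ U c i j Sij))
    ... | inj₂ Dji | inj₂ Sji = proj₁ (avoids-c Dji) (proj₁ (star⁻ U c j i Sji))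

module Greedy {n : ℕ} (G : Graph n) (t : Data.Rational.ℚ) where

  open Counting
  open RationalBounds
  open Forcing G
  open Neighbourhoods G
  open import Data.Bool using (Bool; true; false; _∧_; if_then_else_)
  import Data.Bool as Bool
  open import Data.Bool.Properties using (∧-conicalˡ; ∧-conicalʳ; ∨-comm; not-¬; ¬-not)
  open import Data.Empty using (⊥-elim)
  open import Data.Fin using (Fin; _≟_)
  open import Data.Fin.Properties using (any?)
  open import Data.Nat using (suc; _+_; _<_; z≤n; s≤s)
  open import Data.Nat.Induction using (<-wellFounded)
  open import Data.Product using (_×_; _,_; proj₁; proj₂; ∃-syntax)
  open import Data.Sum using (_⊎_; inj₁; inj₂)
  open import Function using (_∘_)
  import Data.Rational as ℚ
  import Data.Rational.Properties as ℚ
  open import Induction.WellFounded using (Acc; acc)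
  open import Relation.Binary.PropositionalEquality
  open import Relation.Nullary using (yes; no; does)
  open import Relation.Nullary.Decidable using (dec-true; dec-false)

  record StarPacking (U : Fin n → Bool) : Set where
    field
      arc             : PairSet n
      rank            : Fin n → ℕ
      arc-inside      : ∀ {c x} → arc c x ≡ true → U c ≡ true × U x ≡ true
      arc⊆adj         : arc ⊆ₚ adj G
      nested          : NestedStars arc rank
      induced≤t*stars : ℕ→ℚ (arcs (induced U)) ℚ.≤ t ℚ.* ℕ→ℚ (arcs (undirected arc))

  empty : ∀ {U} → (∀ i → U i ≡ false) → StarPacking U
  empty {U} U≡∅ = record
    { arc             = λ _ _ → false
    ; rank            = λ _ → 0
    ; arc-inside      = λ ()
    ; arc⊆adj         = λ _ _ ()
    ; nested          = λ ()
    ; induced≤t*stars = subst₂ (λ a b → ℕ→ℚ a ℚ.≤ t ℚ.* ℕ→ℚ b)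
        (sym (arcs-∅ {n} {induced U} (λ i j → cong (_∧ nbhdIn U i j) (U≡∅ i))))
        (sym (arcs-∅ {n} {undirected (λ _ _ → false)} (λ _ _ → refl)))
        (ℚ.≤-reflexive (sym (ℚ.*-zeroʳ t)))
    }

  -- Ranking the star of c before all stars of the packing of U′ keeps the stars nested,
  -- because those stars lie inside U′, which avoids N[c].
  module Extend {U c} (Uc : U c ≡ true) (avg≤t : avgIn G U c ℚ.≤ t)
                (P : StarPacking (deleteClosedNbhd c U)) where

    open StarPacking P

    U′ : Fin n → Bool
    U′ = deleteClosedNbhd c U

    S : PairSet n
    S = star U c

    arc′ : PairSet n
    arc′ = S ∪ₚ arc

    rank′ : Fin n → ℕ
    rank′ i = if does (i ≟ c) then 0 else suc (rank i)

    kept⇒in : ∀ {i} → U′ i ≡ true → U i ≡ true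
    kept⇒in = proj₁ ∘ deleteClosedNbhd⁻ c U

    kept⇒≢c : ∀ {i} → U′ i ≡ true → i ≢ c
    kept⇒≢c = proj₁ ∘ proj₂ ∘ deleteClosedNbhd⁻ c U

    kept⇒≁c : ∀ {i} → U′ i ≡ true → adj G c i ≡ false
    kept⇒≁c = proj₂ ∘ proj₂ ∘ deleteClosedNbhd⁻ c U

    centre-kept : ∀ {i j} → arc i j ≡ true → U′ i ≡ true
    centre-kept = proj₁ ∘ arc-inside

    rank′-centre : rank′ c ≡ 0
    rank′-centre = cong (if_then 0 else suc (rank c)) (dec-true (c ≟ c) refl)

    rank′-kept : ∀ {i} → U′ i ≡ true → rank′ i ≡ suc (rank i)
    rank′-kept {i} kept = cong (if_then 0 else suc (rank i)) (dec-false (i ≟ c) (kept⇒≢c kept))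

    rank′-mono : ∀ {x y} → U′ x ≡ true → U′ y ≡ true → rank x < rank y → rank′ x < rank′ y
    rank′-mono x-kept y-kept x<y = subst₂ _<_ (sym (rank′-kept x-kept)) (sym (rank′-kept y-kept)) (s≤s x<y)

    arc-avoids-centre : ∀ {i j} → arc i j ≡ true → i ≢ c × j ≢ c
    arc-avoids-centre a = kept⇒≢c (proj₁ (arc-inside a)) , kept⇒≢c (proj₂ (arc-inside a))

    endpoint-kept : ∀ {y z} → undirected arc y z ≡ true → U′ y ≡ true
    endpoint-kept {y} {z} T with ∨-true⁻ (arc y z) T
    ... | inj₁ a = proj₁ (arc-inside a)
    ... | inj₂ a = proj₂ (arc-inside a)

    arc′-inside : ∀ {x y} → arc′ x y ≡ true → U x ≡ true × U y ≡ true
    arc′-inside {x} {y} a with ∨-true⁻ (S x y) a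
    ... | inj₂ a = kept⇒in (proj₁ (arc-inside a)) , kept⇒in (proj₂ (arc-inside a))
    ... | inj₁ s with star⁻ U c x y s
    ...   | refl , c~y = Uc , ∧-conicalˡ (U y) _ c~y

    arc′⊆adj : arc′ ⊆ₚ adj G
    arc′⊆adj x y a with ∨-true⁻ (S x y) a
    ... | inj₂ a = arc⊆adj x y a
    ... | inj₁ s with star⁻ U c x y s
    ...   | refl , c~y = ∧-conicalʳ (U y) _ c~y

    undirected-arc′⁻ : ∀ {y z} → undirected arc′ y z ≡ true →
                       S y z ≡ true ⊎ S z y ≡ true ⊎ undirected arc y z ≡ true
    undirected-arc′⁻ {y} {z} T with ∨-true⁻ (arc′ y z) T
    ... | inj₁ a with ∨-true⁻ (S y z) a
    ...   | inj₁ s = inj₁ s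
    ...   | inj₂ a = inj₂ (inj₂ (∨-introˡ (arc z y) a))
    undirected-arc′⁻ {y} {z} T | inj₂ a with ∨-true⁻ (S z y) a
    ...   | inj₁ s = inj₂ (inj₁ s)
    ...   | inj₂ a = inj₂ (inj₂ (∨-introʳ (arc y z) a))

    lift : ∀ {c′ y z} → U′ c′ ≡ true → EarlierArc arc rank c′ y z → EarlierArc arc′ rank′ c′ y z
    lift {c′} {y} {z} kept (inj₁ (a , y<c′)) = inj₁ (∨-introʳ (S y z) a , rank′-mono (centre-kept a) kept y<c′)
    lift {c′} {y} {z} kept (inj₂ (a , z<c′)) = inj₂ (∨-introʳ (S z y) a , rank′-mono (centre-kept a) kept z<c′)

    ¬undirected-arc′-from-nbhd : ∀ {y z} → adj G c y ≡ true → z ≢ c → undirected arc′ y z ≢ true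
    ¬undirected-arc′-from-nbhd {y} {z} c~y z≢c T with undirected-arc′⁻ T
    ... | inj₁ s with star⁻ U c y z s
    ...   | refl , _ = not-¬ c~y (adj-irrefl G c)
    ¬undirected-arc′-from-nbhd {y} {z} c~y z≢c T | inj₂ (inj₁ s)  = z≢c (proj₁ (star⁻ U c z y s))
    ¬undirected-arc′-from-nbhd {y} {z} c~y z≢c T | inj₂ (inj₂ T′) = not-¬ c~y (kept⇒≁c (endpoint-kept T′))

    nested-kept : ∀ {c′ x y z} → arc c′ x ≡ true → adj G c′ y ≡ true → z ≢ c′ →
                  undirected arc′ y z ≡ true → EarlierArc arc′ rank′ c′ y z
    nested-kept {c′} {x} {y} {z} a c′~y z≢c′ T with undirected-arc′⁻ T
    ... | inj₁ s with star⁻ U c y z s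
    ...   | refl , _ = ⊥-elim (not-¬ (trans (adj-sym G c c′) c′~y) (kept⇒≁c (centre-kept a)))
    nested-kept {c′} {x} {y} {z} a c′~y z≢c′ T | inj₂ (inj₁ s) with star⁻ U c z y s
    ... | refl , _ = inj₂ (∨-introˡ (arc z y) s
                          , subst₂ _<_ (sym rank′-centre) (sym (rank′-kept (centre-kept a))) (s≤s z≤n))
    nested-kept {c′} {x} {y} {z} a c′~y z≢c′ T | inj₂ (inj₂ T′) = lift (centre-kept a) (nested a c′~y z≢c′ T′)

    nested′ : NestedStars arc′ rank′
    nested′ {c′} {x} a c′~y z≢c′ T with ∨-true⁻ (S c′ x) a
    ... | inj₂ a′ = nested-kept a′ c′~y z≢c′ T
    ... | inj₁ s with star⁻ U c c′ x s
    ...   | refl , _ = ⊥-elim (¬undirected-arc′-from-nbhd c′~y z≢c′ T)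

    induced≤t*stars′ : ℕ→ℚ (arcs (induced U)) ℚ.≤ t ℚ.* ℕ→ℚ (arcs (undirected arc′))
    induced≤t*stars′ = begin
      ℕ→ℚ (arcs (induced U))                        ≤⟨ ℕ→ℚ-mono-≤ (arcs-induced-deleteClosedNbhd U c) ⟩
      ℕ→ℚ (arcs (induced U′) + (t₂ + t₂))           ≤⟨ scaled-≤-+ t {arcs (induced U′)} {arcs (undirected arc)}
                                                                     {t₂ + t₂} {d + d} induced≤t*stars walks≤ ⟩
      t ℚ.* ℕ→ℚ (arcs (undirected arc) + (d + d))   ≡⟨ cong (λ a → t ℚ.* ℕ→ℚ a)
                                                            (arcs-undirected-star-∪ U c arc-avoids-centre) ⟨
      t ℚ.* ℕ→ℚ (arcs (undirected arc′))            ∎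
      where
      open ℚ.≤-Reasoning
      d t₂ : ℕ
      d = degIn G U c
      t₂ = twoDegIn G U c
      t₂≤ : ℕ→ℚ t₂ ℚ.≤ t ℚ.* ℕ→ℚ d
      t₂≤ = avgFrom≤⇒≤* t (degIn≡0⇒twoDegIn≡0 U c) avg≤t
      walks≤ : ℕ→ℚ (t₂ + t₂) ℚ.≤ t ℚ.* ℕ→ℚ (d + d)
      walks≤ = scaled-≤-+ t {t₂} {d} {t₂} {d} t₂≤ t₂≤

    packing : StarPacking U
    packing = record
      { arc             = arc′
      ; rank            = rank′
      ; arc-inside      = arc′-inside
      ; arc⊆adj         = arc′⊆adj
      ; nested          = nested′
      ; induced≤t*stars = induced≤t*stars′
      }

  module _ (pick : ∀ U → (∃[ w ] U w ≡ true) → ∃[ v ] (U v ≡ true × avgIn G U v ℚ.≤ t)) where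

    greedy-from : ∀ U → Acc _<_ (size U) → StarPacking U
    greedy-from U (acc smaller) with any? (λ i → U i Bool.≟ true)
    ... | no none = empty (λ i → ¬-not (λ Ui → none (i , Ui)))
    ... | yes some with pick U some
    ...   | c , Uc , avg≤t = Extend.packing Uc avg≤t (greedy-from _ (smaller (size-deleteClosedNbhd Uc)))

    greedy : ∀ U → StarPacking U
    greedy U = greedy-from U (<-wellFounded (size U))

  edges≤t*stars : (P : StarPacking (λ _ → true)) →
                  ℕ→ℚ (numEdges G) ℚ.≤ t ℚ.* ℕ→ℚ ∣ undirected (StarPacking.arc P) ∣ₚ
  edges≤t*stars P = scaled-≤-halve t {numEdges G} {∣ undirected arc ∣ₚ}
    (subst₂ (λ a b → ℕ→ℚ a ℚ.≤ t ℚ.* ℕ→ℚ b)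
            (arcs≡∣∣ₚ+∣∣ₚ (adj-sym G) (adj-irrefl G)) (arcs≡∣∣ₚ+∣∣ₚ T-sym T-irrefl) induced≤t*stars)
    where
    open StarPacking P
    T-sym : ∀ i j → undirected arc i j ≡ undirected arc j i
    T-sym i j = ∨-comm (arc i j) (arc j i)
    T-irrefl : ∀ i → undirected arc i i ≡ false
    T-irrefl i = ¬-not λ T → not-¬ (undirected⊆adj arc⊆adj i i T) (adj-irrefl G i)

open import Data.Bool using (Bool; true)
open import Data.Fin using (Fin)
open import Data.Product using (_×_; ∃-syntax; _,_)
open import Data.Rational using (ℚ; _≤_; _*_; _-_; 1ℚ)
open import Relation.Binary.PropositionalEquality using (_≡_)
open Counting using (_∖ₚ_; undirected; ∣∣ₚ-∖-split)
open RationalBounds using (complement-bound)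

lemma2 : {n : ℕ} (G : Graph n) → Connected G → HasPerfectMatching G →
    (t : ℚ) →
    (∀ (U : Fin n → Bool) → (∃[ w ] U w ≡ true) →
      ∃[ v ] (U v ≡ true × avgIn G U v ≤ t)) →
    ∃[ S ] (IsCompleteForcingSet G S ×
      ℕ→ℚ ∣ S ∣ₚ * t ≤ (t - 1ℚ) * ℕ→ℚ (numEdges G))
lemma2 {n} G _ _ t pick = S , Forcing.undirected-complement-isCompleteForcingSet G nested , bound
  where
  open Greedy G t
  packing : StarPacking (λ _ → true)
  packing = greedy pick (λ _ → true)
  open StarPacking packing
  T S : PairSet n
  T = undirected arc
  S = adj G ∖ₚ T
  bound : ℕ→ℚ ∣ S ∣ₚ * t ≤ (t - 1ℚ) * ℕ→ℚ (numEdges G)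
  bound = complement-bound {∣ S ∣ₚ} {∣ T ∣ₚ} t (∣∣ₚ-∖-split (Forcing.undirected⊆adj G arc⊆adj))
                           (edges≤t*stars packing)
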